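{- Let $\Delta$ be a positive integer. If $G$ is a $\rho$-$\Delta$-critical graph, then $G$ is connected.
   Context: All graphs are simple. For a graph $G$, an incidence is a pair $(v,e)$ with $v$ an endpoint of the edge $e$; $I(G)$ is the set of incidences. For $u\in V(G)$ and a neighbor $v$, $(u,uv)$ is a strong incidence of $u$ and $(v,uv)$ is a weak incidence of $u$; $I_u$, $A_u$ denote the sets of strong, resp. weak, incidences of $u$. Let $[\Delta]=\{1,\dots,\Delta\}$. A conditional incidence $\Delta$-coloring of $G$ is a map $\varphi: I(G)\to[\Delta]$ such that: (a) $(u,uv)$ and $(v,uv)$ receive distinct colors for each edge $uv$; (b) each color appears at most once among $A_u$ for each vertex $u$; (c) each color appears at most once among $I_u$ for each vertex $u$; (d) each color of $[\Delta]$ appears at least once among $A_u\cup I_u$ for each vertex $u$ with $\deg_G(u)\geq\Delta-1$. A graph $G$ is $\rho$-$\Delta$-critical if $\Delta(G)\leq\Delta$, $G$ has no conditional incidence $\Delta$-coloring, but every proper subgraph of $G$ has one. -}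

module Defs where

open import Data.Nat using (ℕ; _≤_; _∸_)
open import Data.Bool using (Bool; true; false; if_then_else_)
open import Data.Fin using (Fin)
open import Data.List using (map; allFin)
open import Data.Nat.ListAction using (sum)
open import Data.Product using (Σ; ∃; _×_)
open import Data.Sum using (_⊎_)
open import Relation.Binary.PropositionalEquality using (_≡_; _≢_)
open import Relation.Nullary using (¬_)

record Graph : Set where
  field
    n     : ℕ
    adj   : Fin n → Fin n → Bool
    sym   : ∀ u v → adj u v ≡ adj v u
    irref : ∀ u → adj u u ≡ false

open Graph public

Adj : (G : Graph) → Fin (n G) → Fin (n G) → Set
Adj G u v = adj G u v ≡ true

deg : (G : Graph) → Fin (n G) → ℕ
deg G u = sum (map (λ v → if adj G u v then 1 else 0) (allFin (n G)))

MaxDegLe : Graph → ℕ → Set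
MaxDegLe G Δ = ∀ u → deg G u ≤ Δ

-- The incidence (u, uv) (for an edge uv)
-- receives colour φ u v ∈ [Δ] (represented as Fin Δ); values of φ on
-- non-adjacent pairs are irrelevant.  For vertex u, the strong incidences are
-- (u,uv) with colour φ u v, the weak incidences are (v,uv) with colour φ v u.
record IsCondIncColoring (G : Graph) (Δ : ℕ) (φ : Fin (n G) → Fin (n G) → Fin Δ) : Set where
  field
    condA : ∀ u v → Adj G u v → φ u v ≢ φ v u
    condB : ∀ u v w → Adj G u v → Adj G u w → φ v u ≡ φ w u → v ≡ w
    condC : ∀ u v w → Adj G u v → Adj G u w → φ u v ≡ φ u w → v ≡ w
    condD : ∀ u → Δ ∸ 1 ≤ deg G u → ∀ (c : Fin Δ) →
            ∃ λ v → Adj G u v × (φ u v ≡ c ⊎ φ v u ≡ c)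

HasCondIncColoring : Graph → ℕ → Set
HasCondIncColoring G Δ = Σ (Fin (n G) → Fin (n G) → Fin Δ) (IsCondIncColoring G Δ)

record SubgraphVia (H G : Graph) (f : Fin (n H) → Fin (n G)) : Set where
  field
    inj      : ∀ a b → f a ≡ f b → a ≡ b
    edgePres : ∀ a b → Adj H a b → Adj G (f a) (f b)

ProperVia : (H G : Graph) → (Fin (n H) → Fin (n G)) → Set
ProperVia H G f =
  (∃ λ v → ∀ a → f a ≢ v) ⊎
  (∃ λ a → ∃ λ b → Adj G (f a) (f b) × adj H a b ≡ false)

ProperSubgraph : Graph → Graph → Set
ProperSubgraph H G = ∃ λ f → SubgraphVia H G f × ProperVia H G f

record RhoCritical (Δ : ℕ) (G : Graph) : Set where
  field
    maxDeg  : MaxDegLe G Δ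
    noColor : ¬ HasCondIncColoring G Δ
    minimal : ∀ H → ProperSubgraph H G → HasCondIncColoring H Δ

data Walk (G : Graph) : Fin (n G) → Fin (n G) → Set where
  here : ∀ {u} → Walk G u u
  step : ∀ {u v w} → Adj G u v → Walk G v w → Walk G u w

Connected : Graph → Set
Connected G = ∀ u v → Walk G u v

-- For Δ = 1, condition (d) applies at every vertex and forces an edge there, whose two
-- incidences cannot get distinct colours; hence no graph with a vertex is colourable, and a
-- critical graph, which stays colourable after deleting a vertex, has at most one vertex.
-- For Δ ≥ 2 the four conditions at a vertex only involve its own incidences. A critical
-- graph has no isolated vertex w: its degree 0 is below Δ − 1, so any colouring of G − w
-- extends to G. If u and v were in different components, let S be the component of u:
-- keeping only the edges inside S, respectively inside its complement, loses an edge at v,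
-- respectively at u, so both are proper subgraphs, and their colourings glue to one of G.
module Submission where

open import Defs hiding (sym)
open import Data.Bool using (Bool; true; false; if_then_else_; _∧_)
open import Data.Bool.Properties using (∧-comm; ∧-zeroʳ; ¬-not) renaming (_≟_ to _≟ᵇ_)
open import Data.Fin using (Fin; zero; suc; punchIn; punchOut)
open import Data.Fin.Properties using (punchIn-injective; punchInᵢ≢i; punchIn-punchOut; punchOut-cong; punchOut-punchIn; any?)
  renaming (_≟_ to _≟ᶠ_)
open import Data.Fin.Subset using (Subset; _∈_; _∉_; _⊃_; ∁; _∪_; ⁅_⁆)
open import Data.Fin.Subset.Induction using (⊃-wellFounded)
open import Data.Fin.Subset.Properties
  using (_∈?_; p⊆p∪q; x∈p∪q⁻; x∈p∪q⁺; x∈⁅x⁆; x∈⁅y⁆⇒x≡y; x∈∁p⇒x∉p; x∉p⇒x∈∁p; x∈p⇒x∉∁p)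
open import Data.List using (tabulate; allFin)
open import Data.List.Properties using (map-cong; map-tabulate)
open import Data.Maybe using (Maybe; just; nothing; zipWith; fromMaybe)
open import Data.Nat using (ℕ; zero; suc; pred; _+_; _∸_; _≤_; _≥_; z≤n)
open import Data.Nat.ListAction using (sum)
open import Data.Nat.Properties using (≤-reflexive; ≤-trans; +-commutativeSemigroup)
open import Algebra.Properties.CommutativeSemigroup +-commutativeSemigroup using (x∙yz≈y∙xz)
open import Data.Product using (∃; _×_; _,_; proj₁; proj₂)
open import Data.Sum using (_⊎_; inj₁; inj₂)
open import Data.Vec using (lookup)
open import Data.Vec.Properties using ([]=⇒lookup; lookup⇒[]=)
open import Function using (_∘_)
open import Induction.WellFounded using (Acc; acc)
open import Relation.Binary.PropositionalEquality
open import Relation.Nullary using (¬_; Dec; yes; no; contradiction; ¬?)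
open import Relation.Nullary.Decidable using (_×-dec_)

-- punchIn for vertex sets Fin (n G) whose size is not syntactically a successor.
skip : ∀ {m} → Fin m → Fin (pred m) → Fin m
skip {suc _} w = punchIn w

skip-injective : ∀ {m} (w : Fin m) {p q} → skip w p ≡ skip w q → p ≡ q
skip-injective {suc _} w = punchIn-injective w _ _

skip≢ : ∀ {m} (w : Fin m) p → skip w p ≢ w
skip≢ {suc _} = punchInᵢ≢i

skip-surjective : ∀ {m} {w x : Fin m} → w ≢ x → ∃ λ p → skip w p ≡ x
skip-surjective {suc _} w≢x = punchOut w≢x , punchIn-punchOut w≢x

unskip : ∀ {m} → Fin m → Fin m → Maybe (Fin (pred m))
unskip {suc _} w x with w ≟ᶠ x
... | yes _ = nothing
... | no w≢x = just (punchOut w≢x)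

unskip-skip : ∀ {m} (w : Fin m) p → unskip w (skip w p) ≡ just p
unskip-skip {suc _} w p with w ≟ᶠ punchIn w p
... | yes w≡ = contradiction (sym w≡) (punchInᵢ≢i w p)
... | no _ = cong just (trans (punchOut-cong w refl) (punchOut-punchIn w))

sum-tabulate-skip : ∀ {m} (g : Fin m → ℕ) w →
                    sum (tabulate g) ≡ g w + sum (tabulate (g ∘ skip w))
sum-tabulate-skip {suc _} g zero = refl
sum-tabulate-skip {suc (suc m)} g (suc w) = begin
  g zero + sum (tabulate (g ∘ suc))
    ≡⟨ cong (g zero +_) (sum-tabulate-skip (g ∘ suc) w) ⟩
  g zero + (g (suc w) + sum (tabulate (g ∘ suc ∘ punchIn w)))
    ≡⟨ x∙yz≈y∙xz (g zero) (g (suc w)) _ ⟩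
  g (suc w) + (g zero + sum (tabulate (g ∘ suc ∘ punchIn w))) ∎
  where open ≡-Reasoning

sum-tabulate-zero : ∀ {m} {g : Fin m → ℕ} → (∀ i → g i ≡ 0) → sum (tabulate g) ≡ 0
sum-tabulate-zero {zero} _ = refl
sum-tabulate-zero {suc m} g≡0 = cong₂ _+_ (g≡0 zero) (sum-tabulate-zero (g≡0 ∘ suc))

Colouring : Graph → ℕ → Set
Colouring G Δ = Fin (n G) → Fin (n G) → Fin Δ

Isolated : (G : Graph) → Fin (n G) → Set
Isolated G w = ∀ y → ¬ Adj G w y

Closed : (G : Graph) → Subset (n G) → Set
Closed G S = ∀ {x y} → x ∈ S → Adj G x y → y ∈ S

Adj-sym : (G : Graph) {x y : Fin (n G)} → Adj G x y → Adj G y x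
Adj-sym G {x} {y} e = trans (Graph.sym G y x) e

∁-closed : (G : Graph) {S : Subset (n G)} → Closed G S → Closed G (∁ S)
∁-closed G closed x∈∁S e = x∉p⇒x∈∁p λ y∈S → x∈∁p⇒x∉p x∈∁S (closed y∈S (Adj-sym G e))

indicator : Bool → ℕ
indicator b = if b then 1 else 0

deg-tabulate : (G : Graph) (u : Fin (n G)) → deg G u ≡ sum (tabulate (indicator ∘ adj G u))
deg-tabulate G u = cong sum (map-tabulate (λ v → v) (indicator ∘ adj G u))

deg-isolated : (G : Graph) {w : Fin (n G)} → Isolated G w → deg G w ≡ 0
deg-isolated G {w} iso = trans (deg-tabulate G w) (sum-tabulate-zero λ y → cong indicator (¬-not (iso y)))

_─_ : (G : Graph) → Fin (n G) → Graph
G ─ w = record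
  { n     = pred (n G)
  ; adj   = λ x y → adj G (skip w x) (skip w y)
  ; sym   = λ x y → Graph.sym G (skip w x) (skip w y)
  ; irref = λ x → irref G (skip w x)
  }

─-proper : (G : Graph) (w : Fin (n G)) → ProperSubgraph (G ─ w) G
─-proper G w = skip w , subgraph , inj₁ (w , skip≢ w)
  where
  subgraph : SubgraphVia (G ─ w) G (skip w)
  subgraph = record { inj = λ _ _ → skip-injective w ; edgePres = λ _ _ e → e }

deg-─ : (G : Graph) {w : Fin (n G)} → Isolated G w → ∀ p → deg G (skip w p) ≡ deg (G ─ w) p
deg-─ G {w} iso p = begin
  deg G (skip w p)
    ≡⟨ deg-tabulate G (skip w p) ⟩
  sum (tabulate (indicator ∘ adj G (skip w p)))
    ≡⟨ sum-tabulate-skip (indicator ∘ adj G (skip w p)) w ⟩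
  indicator (adj G (skip w p) w) + sum (tabulate (indicator ∘ adj G (skip w p) ∘ skip w))
    ≡⟨ cong₂ (λ b d → indicator b + d) (trans (Graph.sym G _ w) (¬-not (iso (skip w p))))
             (sym (deg-tabulate (G ─ w) p)) ⟩
  deg (G ─ w) p ∎
  where open ≡-Reasoning

_↾_ : (G : Graph) → Subset (n G) → Graph
G ↾ S = record
  { n     = n G
  ; adj   = λ x y → (lookup S x ∧ lookup S y) ∧ adj G x y
  ; sym   = λ x y → cong₂ _∧_ (∧-comm (lookup S x) (lookup S y)) (Graph.sym G x y)
  ; irref = λ x → trans (cong (_ ∧_) (irref G x)) (∧-zeroʳ _)
  }

↾-adj⇒adj : (G : Graph) (S : Subset (n G)) {x y : Fin (n G)} → Adj (G ↾ S) x y → Adj G x y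
↾-adj⇒adj G S {x} {y} e with lookup S x ∧ lookup S y
... | true = e

↾-adj-inside : (G : Graph) {S : Subset (n G)} → Closed G S →
               ∀ {x} → x ∈ S → ∀ y → adj (G ↾ S) x y ≡ adj G x y
↾-adj-inside G {S} closed {x} x∈S y with adj G x y in e
... | false = ∧-zeroʳ _
... | true rewrite []=⇒lookup x∈S | []=⇒lookup (closed x∈S e) = refl

↾-proper : (G : Graph) (S : Subset (n G)) {x y : Fin (n G)} → x ∉ S → Adj G x y → ProperSubgraph (G ↾ S) G
↾-proper G S {x} {y} x∉S e = (λ v → v) , subgraph , inj₂ (x , y , e , edge-removed)
  where
  subgraph : SubgraphVia (G ↾ S) G (λ v → v)
  subgraph = record { inj = λ _ _ eq → eq ; edgePres = λ _ _ → ↾-adj⇒adj G S }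
  edge-removed : adj (G ↾ S) x y ≡ false
  edge-removed rewrite ¬-not (x∉S ∘ lookup⇒[]= x S) = refl

deg-↾ : (G : Graph) {S : Subset (n G)} → Closed G S → ∀ {x} → x ∈ S → deg (G ↾ S) x ≡ deg G x
deg-↾ G {S} closed x∈S = cong sum (map-cong (cong indicator ∘ ↾-adj-inside G closed x∈S) (allFin (n G)))

record ColouredAt (G : Graph) (Δ : ℕ) (φ : Colouring G Δ) (u : Fin (n G)) : Set where
  field
    edge-distinct    : ∀ v → Adj G u v → φ u v ≢ φ v u
    weak-injective   : ∀ v w → Adj G u v → Adj G u w → φ v u ≡ φ w u → v ≡ w
    strong-injective : ∀ v w → Adj G u v → Adj G u w → φ u v ≡ φ u w → v ≡ w
    saturated        : Δ ∸ 1 ≤ deg G u → ∀ c → ∃ λ v → Adj G u v × (φ u v ≡ c ⊎ φ v u ≡ c)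

open ColouredAt

colouredAt : {G : Graph} {Δ : ℕ} {φ : Colouring G Δ} → IsCondIncColoring G Δ φ → ∀ u → ColouredAt G Δ φ u
colouredAt c u = record
  { edge-distinct    = IsCondIncColoring.condA c u
  ; weak-injective   = IsCondIncColoring.condB c u
  ; strong-injective = IsCondIncColoring.condC c u
  ; saturated        = IsCondIncColoring.condD c u
  }

colouredAt-all : {G : Graph} {Δ : ℕ} {φ : Colouring G Δ} → (∀ u → ColouredAt G Δ φ u) → IsCondIncColoring G Δ φ
colouredAt-all c = record
  { condA = edge-distinct ∘ c
  ; condB = weak-injective ∘ c
  ; condC = strong-injective ∘ c
  ; condD = saturated ∘ c
  }

-- The conditions at a vertex only see its incidences, so they transfer along any map
-- carrying the neighbourhood of p onto that of f p.
colouredAt-transfer :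
  {G H : Graph} {Δ : ℕ} {φ : Colouring G Δ} {ψ : Colouring H Δ}
  (f : Fin (n H) → Fin (n G)) (p : Fin (n H)) →
  (∀ y → Adj G (f p) y → ∃ λ q → Adj H p q × f q ≡ y) →
  (∀ q → Adj H p q → Adj G (f p) (f q)) →
  deg G (f p) ≤ deg H p →
  (∀ q → Adj H p q → φ (f p) (f q) ≡ ψ p q × φ (f q) (f p) ≡ ψ q p) →
  ColouredAt H Δ ψ p → ColouredAt G Δ φ (f p)
colouredAt-transfer {G} {H} {Δ} {φ} {ψ} f p lift push deg≤ agree c = record
  { edge-distinct    = distinct
  ; weak-injective   = weak
  ; strong-injective = strong
  ; saturated        = sat
  }
  where
  distinct : ∀ y → Adj G (f p) y → φ (f p) y ≢ φ y (f p)
  distinct y e with lift y e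
  ... | q , e′ , refl = λ eq →
    edge-distinct c q e′ (trans (sym (proj₁ (agree q e′))) (trans eq (proj₂ (agree q e′))))

  weak : ∀ y z → Adj G (f p) y → Adj G (f p) z → φ y (f p) ≡ φ z (f p) → y ≡ z
  weak y z e₁ e₂ eq with lift y e₁ | lift z e₂
  ... | q , e₁′ , refl | r , e₂′ , refl = cong f (weak-injective c q r e₁′ e₂′
    (trans (sym (proj₂ (agree q e₁′))) (trans eq (proj₂ (agree r e₂′)))))

  strong : ∀ y z → Adj G (f p) y → Adj G (f p) z → φ (f p) y ≡ φ (f p) z → y ≡ z
  strong y z e₁ e₂ eq with lift y e₁ | lift z e₂
  ... | q , e₁′ , refl | r , e₂′ , refl = cong f (strong-injective c q r e₁′ e₂′
    (trans (sym (proj₁ (agree q e₁′))) (trans eq (proj₁ (agree r e₂′)))))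

  sat : Δ ∸ 1 ≤ deg G (f p) → ∀ col → ∃ λ y → Adj G (f p) y × (φ (f p) y ≡ col ⊎ φ y (f p) ≡ col)
  sat big col with saturated c (≤-trans big deg≤) col
  ... | q , e , inj₁ out = f q , push q e , inj₁ (trans (proj₁ (agree q e)) out)
  ... | q , e , inj₂ inc = f q , push q e , inj₂ (trans (proj₂ (agree q e)) inc)

isolated-colouredAt : (G : Graph) {k : ℕ} (φ : Colouring G (2 + k)) {w : Fin (n G)} →
                      Isolated G w → ColouredAt G (2 + k) φ w
isolated-colouredAt G φ iso = record
  { edge-distinct    = λ v e → contradiction e (iso v)
  ; weak-injective   = λ v _ e → contradiction e (iso v)
  ; strong-injective = λ v _ e → contradiction e (iso v)
  ; saturated        = λ big → contradiction (subst (_ ≤_) (deg-isolated G iso) big) λ ()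
  }

↾-colouredAt : (G : Graph) {Δ : ℕ} {S : Subset (n G)} {φ : Colouring G Δ} {ψ : Colouring (G ↾ S) Δ} →
               Closed G S → (∀ {x} → x ∈ S → ∀ y → φ x y ≡ ψ x y) →
               ∀ {x} → x ∈ S → ColouredAt (G ↾ S) Δ ψ x → ColouredAt G Δ φ x
↾-colouredAt G {S = S} closed agree {x} x∈S = colouredAt-transfer (λ v → v) x
  (λ y e → y , trans (↾-adj-inside G closed x∈S y) e , refl)
  (λ _ → ↾-adj⇒adj G S)
  (≤-reflexive (sym (deg-↾ G closed x∈S)))
  (λ y e → agree x∈S y , agree (closed x∈S (↾-adj⇒adj G S e)) x)

colouring-from-sides : (G : Graph) {Δ : ℕ} {S : Subset (n G)} → Closed G S →
                       HasCondIncColoring (G ↾ S) Δ → HasCondIncColoring (G ↾ ∁ S) Δ → HasCondIncColoring G Δ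
colouring-from-sides G {Δ} {S} closed (ψ₁ , ψ₁-colouring) (ψ₂ , ψ₂-colouring) = φ , colouredAt-all local
  where
  φ : Colouring G Δ
  φ x y = if lookup S x then ψ₁ x y else ψ₂ x y

  agree₁ : ∀ {x} → x ∈ S → ∀ y → φ x y ≡ ψ₁ x y
  agree₁ x∈S y rewrite []=⇒lookup x∈S = refl

  agree₂ : ∀ {x} → x ∈ ∁ S → ∀ y → φ x y ≡ ψ₂ x y
  agree₂ {x} x∈∁S y rewrite ¬-not (x∈∁p⇒x∉p x∈∁S ∘ lookup⇒[]= x S) = refl

  local : ∀ x → ColouredAt G Δ φ x
  local x with x ∈? S
  ... | yes x∈S = ↾-colouredAt G closed agree₁ x∈S (colouredAt ψ₁-colouring x)
  ... | no x∉S  = ↾-colouredAt G (∁-closed G closed) agree₂ (x∉p⇒x∈∁p x∉S) (colouredAt ψ₂-colouring x)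

-- The colours at the isolated vertex w are junk: w has no incidences.
extend-over-isolated : (G : Graph) {k : ℕ} {w : Fin (n G)} → Isolated G w →
                       HasCondIncColoring (G ─ w) (2 + k) → HasCondIncColoring G (2 + k)
extend-over-isolated G {k} {w} iso (ψ , ψ-colouring) = φ , colouredAt-all local
  where
  φ : Colouring G (2 + k)
  φ x y = fromMaybe zero (zipWith ψ (unskip w x) (unskip w y))

  φ-skip : ∀ p q → φ (skip w p) (skip w q) ≡ ψ p q
  φ-skip p q rewrite unskip-skip w p | unskip-skip w q = refl

  neighbours-skip : ∀ p y → Adj G (skip w p) y → ∃ λ q → Adj (G ─ w) p q × skip w q ≡ y
  neighbours-skip p y e with skip-surjective {w = w} {y} (λ { refl → iso (skip w p) (Adj-sym G e) })
  ... | q , refl = q , e , refl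

  local : ∀ x → ColouredAt G (2 + k) φ x
  local x with w ≟ᶠ x
  ... | yes refl = isolated-colouredAt G φ iso
  ... | no w≢x with skip-surjective w≢x
  ...   | p , refl = colouredAt-transfer (skip w) p (neighbours-skip p) (λ _ e → e)
                       (≤-reflexive (deg-─ G iso p)) (λ q _ → φ-skip p q , φ-skip q p)
                       (colouredAt ψ-colouring p)

Reachable : (G : Graph) → Fin (n G) → Subset (n G) → Set
Reachable G u S = ∀ {x} → x ∈ S → Walk G u x

Escapes : (G : Graph) → Subset (n G) → Set
Escapes G S = ∃ λ x → ∃ λ y → x ∈ S × Adj G x y × y ∉ S

escapes? : (G : Graph) (S : Subset (n G)) → Dec (Escapes G S)
escapes? G S = any? λ x → any? λ y → x ∈? S ×-dec adj G x y ≟ᵇ true ×-dec ¬? (y ∈? S)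

¬escapes⇒closed : (G : Graph) {S : Subset (n G)} → ¬ Escapes G S → Closed G S
¬escapes⇒closed G {S} no-escape {x} {y} x∈S e with y ∈? S
... | yes y∈S = y∈S
... | no y∉S  = contradiction (x , y , x∈S , e , y∉S) no-escape

walk-snoc : {G : Graph} {u x y : Fin (n G)} → Walk G u x → Adj G x y → Walk G u y
walk-snoc here e′       = step e′ here
walk-snoc (step e w) e′ = step e (walk-snoc w e′)

component : (G : Graph) (u : Fin (n G)) → ∃ λ S → u ∈ S × Reachable G u S × Closed G S
component G u = grow ⁅ u ⁆ (⊃-wellFounded ⁅ u ⁆) (x∈⁅x⁆ u) λ x∈⁅u⁆ → subst (Walk G u) (sym (x∈⁅y⁆⇒x≡y u x∈⁅u⁆)) here
  where
  grow : ∀ S → Acc _⊃_ S → u ∈ S → Reachable G u S → ∃ λ T → u ∈ T × Reachable G u T × Closed G T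
  grow S (acc larger) u∈S reach with escapes? G S
  ... | no no-escape = S , u∈S , reach , ¬escapes⇒closed G no-escape
  ... | yes (x , y , x∈S , e , y∉S) = grow (S ∪ ⁅ y ⁆) (larger S⊂S∪y) (p⊆p∪q _ u∈S) reach′
    where
    S⊂S∪y : (S ∪ ⁅ y ⁆) ⊃ S
    S⊂S∪y = p⊆p∪q _ , y , x∈p∪q⁺ (inj₂ (x∈⁅x⁆ y)) , y∉S

    reach′ : Reachable G u (S ∪ ⁅ y ⁆)
    reach′ z∈ with x∈p∪q⁻ S ⁅ y ⁆ z∈
    ... | inj₁ z∈S = reach z∈S
    ... | inj₂ z∈y rewrite x∈⁅y⁆⇒x≡y y z∈y = walk-snoc (reach x∈S) e

one-colour-impossible : (H : Graph) → Fin (n H) → ¬ HasCondIncColoring H 1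
one-colour-impossible H p (φ , colouring) with IsCondIncColoring.condD colouring p z≤n zero
... | q , e , _ = IsCondIncColoring.condA colouring p q e (Fin1-unique (φ p q) (φ q p))
  where
  Fin1-unique : (i j : Fin 1) → i ≡ j
  Fin1-unique zero zero = refl

critical₁⇒subsingleton : {G : Graph} → RhoCritical 1 G → (u v : Fin (n G)) → u ≡ v
critical₁⇒subsingleton {G} R u v with u ≟ᶠ v
... | yes u≡v = u≡v
... | no u≢v  = contradiction (RhoCritical.minimal R (G ─ u) (─-proper G u))
                  (one-colour-impossible (G ─ u) (proj₁ (skip-surjective u≢v)))

critical⇒neighbour : {G : Graph} {k : ℕ} → RhoCritical (2 + k) G → ∀ w → ∃ λ y → Adj G w y
critical⇒neighbour {G} R w with any? (λ y → adj G w y ≟ᵇ true)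
... | yes neighbour = neighbour
... | no isolated   = contradiction
  (extend-over-isolated G (λ y e → isolated (y , e)) (RhoCritical.minimal R (G ─ w) (─-proper G w)))
  (RhoCritical.noColor R)

critical⇒connected : {G : Graph} {k : ℕ} → RhoCritical (2 + k) G → Connected G
critical⇒connected {G} {k} R u v with component G u
... | S , u∈S , reach , closed with v ∈? S
...   | yes v∈S = reach v∈S
...   | no v∉S  = contradiction
  (colouring-from-sides G closed (side-colourable v∉S) (side-colourable (x∈p⇒x∉∁p u∈S)))
  (RhoCritical.noColor R)
  where
  side-colourable : ∀ {T x} → x ∉ T → HasCondIncColoring (G ↾ T) (2 + k)
  side-colourable {T} {x} x∉T =
    RhoCritical.minimal R (G ↾ T) (↾-proper G T x∉T (proj₂ (critical⇒neighbour R x)))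

lemma10 : (Δ : ℕ) → Δ ≥ 1 → (G : Graph) → RhoCritical Δ G → Connected G
lemma10 (suc zero)    _ G R u v = subst (Walk G u) (critical₁⇒subsingleton R u v) here
lemma10 (suc (suc k)) _ G R     = critical⇒connected R
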